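{- Let $D$ be a digraph on $\{1,\dots,n\}$ and $q\ge3$. The following are equivalent: (1) $F[D,q]$ contains a permutation of $[q]^n$; (2) there exist $f\in F[D,q]$ and a block-sequential schedule $\sigma$ such that $f^\sigma$ is a permutation of $[q]^n$; (3) all the vertices of $D$ can be covered by pairwise vertex-disjoint cycles.
   Context: A digraph $D=(V,E)$ has $V=\{1,\dots,n\}$, $E\subseteq V^2$ (loops allowed; a loop is a cycle of length one). With $[q]=\{0,\dots,q-1\}$, for $f:[q]^n\to[q]^n$, $\mathrm{IG}(f)$ is the digraph on $V$ with $(u,v)$ an arc iff $f_v$ depends essentially on $x_u$; $F[D,q]=\{f:\mathrm{IG}(f)=D\}$. A schedule is a sequence $\sigma=(\sigma_1,\dots,\sigma_t)$ of subsets of $V$; for $S\subseteq V$, $f^{(S)}_v(x)=f_v(x)$ if $v\in S$ and $x_v$ otherwise; $f^\sigma=f^{(\sigma_t)}\circ\dots\circ f^{(\sigma_1)}$. $\sigma$ is block-sequential if $\bigcup_i\sigma_i=V$ and the $\sigma_i$ are pairwise disjoint. -}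

module Defs where

open import Data.Nat using (ℕ; _≤_)
open import Data.Fin using (Fin)
open import Data.Bool using (Bool; true; false; if_then_else_)
open import Data.Vec using (Vec; lookup; tabulate; _[_]≔_)
open import Data.List using (List; []; _∷_; _++_; [_]; length; concat)
import Data.List as L
open import Data.List.Relation.Unary.Unique.Propositional using (Unique)
import Data.List.Membership.Propositional as LM
open import Data.Fin.Subset using (Subset)
import Data.Fin.Subset as Sub
open import Data.Product using (Σ; ∃; _×_; _,_)
open import Data.Empty using (⊥)
open import Data.Unit using (⊤)
open import Relation.Nullary using (¬_)
open import Relation.Binary.PropositionalEquality using (_≡_; _≢_)
open import Function.Bundles using (_⇔_)
open import Function.Definitions using (Bijective)

-- A digraph on V = Fin n (vertices 1..n are Fin n), loops allowed:
-- D u v ≡ true  iff  (u , v) ∈ E.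
Digraph : ℕ → Set
Digraph n = Fin n → Fin n → Bool

Arc : ∀ {n} → Digraph n → Fin n → Fin n → Set
Arc D u v = D u v ≡ true

Config : ℕ → ℕ → Set
Config q n = Vec (Fin q) n

DependsOn : ∀ {q n} → (Config q n → Config q n) → Fin n → Fin n → Set
DependsOn {q} f u v =
  Σ (Config q _) λ x → Σ (Fin q) λ a →
    lookup (f x) v ≢ lookup (f (x [ u ]≔ a)) v

HasIG : ∀ {q n} → (Config q n → Config q n) → Digraph n → Set
HasIG f D = ∀ u v → (Arc D u v ⇔ DependsOn f u v)

InF : ∀ {n} → Digraph n → (q : ℕ) → (Config q n → Config q n) → Set
InF D q f = HasIG f D

IsPermutation : ∀ {q n} → (Config q n → Config q n) → Set
IsPermutation f = Bijective _≡_ _≡_ f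

update : ∀ {q n} → (Config q n → Config q n) → Subset n → Config q n → Config q n
update f S x = tabulate λ v → if lookup S v then lookup (f x) v else lookup x v

Schedule : ℕ → Set
Schedule n = List (Subset n)

applySchedule : ∀ {q n} → (Config q n → Config q n) → Schedule n → Config q n → Config q n
applySchedule f [] x = x
applySchedule f (S ∷ σ) x = applySchedule f σ (update f S x)

BlockSequential : ∀ {n} → Schedule n → Set
BlockSequential {n} σ =
  (∀ (v : Fin n) → ∃ λ (i : Fin (length σ)) → v Sub.∈ L.lookup σ i)
  × (∀ (i j : Fin (length σ)) → i ≢ j → ∀ (v : Fin n) →
       v Sub.∈ L.lookup σ i → v Sub.∈ L.lookup σ j → ⊥)

Walk : ∀ {n} → Digraph n → List (Fin n) → Set
Walk D [] = ⊤
Walk D (v ∷ []) = ⊤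
Walk D (u ∷ v ∷ vs) = Arc D u v × Walk D (v ∷ vs)

-- a cycle (v_1 … v_k), k ≥ 1, distinct vertices, arcs v_i → v_{i+1} and v_k → v_1
-- (a loop is a cycle of length one)
IsCycle : ∀ {n} → Digraph n → List (Fin n) → Set
IsCycle D [] = ⊥
IsCycle D (v ∷ vs) = Unique (v ∷ vs) × Walk D ((v ∷ vs) ++ [ v ])

CycleCover : ∀ {n} → Digraph n → Set
CycleCover {n} D =
  Σ (List (List (Fin n))) λ cs →
    (∀ c → c LM.∈ cs → IsCycle D c)
    × (∀ (i j : Fin (length cs)) → i ≢ j → ∀ (v : Fin n) →
         v LM.∈ L.lookup cs i → v LM.∈ L.lookup cs j → ⊥)
    × (∀ (v : Fin n) → ∃ λ (i : Fin (length cs)) → v LM.∈ L.lookup cs i)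

-- If f is a bijection with IG(f) ⊆ D, then for every set T of vertices the values of f on T are
-- determined by the values on the in-neighbourhood N⁻(T), so q^|T| ≤ q^|N⁻(T)|. Hall's theorem then
-- chooses injectively an in-neighbour p(v) of every vertex v, and the orbits of the permutation p⁻¹
-- are vertex-disjoint cycles covering D. Under a block-sequential schedule every block update f^(S)
-- is itself a bijection, whose interaction graph lies within the arcs of D into S and the loops
-- outside S, and the same argument provides p block by block. Conversely, given p from a cycle cover,
-- let f_v(x) be x_{p(v)} with the values 1 and 2 exchanged exactly when all other in-neighbours of v
-- carry nonzero values; this f is a bijection with interaction graph D. Exchanging 1 and 2 while
-- fixing 0 is where q ≥ 3 is needed.

module Submission where

open import Defs
open import Data.Nat using (ℕ; _≤_)
open import Data.Nat.Properties using (≤-trans; n≤1+n)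
open import Data.Product using (Σ; _×_; _,_)
open import Function using (_∘_)
open import Function.Bundles using (_⇔_; mk⇔)

module Hall where

  open import Data.Nat using (ℕ; zero; suc; _+_; _≤_; _<_; _≤?_; _<?_; z≤n)
  open import Data.Nat.Properties
    using (+-suc; +-comm; +-identityʳ; m≤m+n; +-monoʳ-≤; +-cancelʳ-≤; ≤-refl; ≤-trans; ≤-pred; ≤-<-trans;
           >⇒≢; <⇒≱; ≰⇒>; module ≤-Reasoning)
  open import Data.Bool using (true; false; if_then_else_)
  import Data.Bool.Properties as Bool
  open import Data.Fin using (Fin)
  open import Data.Fin.Properties using (any?; _≟_)
  open import Data.Fin.Subset
    using (Subset; inside; outside; _∈_; _∉_; _⊆_; _∪_; _∩_; _─_; _-_; ⁅_⁆; ∣_∣; Nonempty; Empty)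
  open import Data.Fin.Subset.Properties
    using (_∈?_; _⊆?_; nonempty?; anySubset?; Empty-unique; ∣⊥∣≡0; ⊆-trans; p⊆q⇒∣p∣≤∣q∣; x∈p⇒∣p-x∣<∣p∣;
           ∣⁅x⁆∣≡1; x∈⁅x⁆; x∈⁅y⁆⇒x≡y; p⊆p∪q; q⊆p∪q; x∈p∪q⁺; x∈p∪q⁻; x∈p∩q⁻; p─q⊆p; x∈p∧x∉q⇒x∈p─q;
           x∈p∧x≢y⇒x∈p-y)
  open import Data.Vec using ([]; _∷_; there; tabulate)
  open import Data.Vec.Properties using (lookup∘tabulate; lookup⇒[]=; []=⇒lookup)
  open import Data.Product using (∃; _×_; _,_; proj₁; proj₂; uncurry)
  open import Data.Sum using (inj₁; inj₂)
  open import Function using (_∘_; id)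
  open import Level using (Level)
  open import Relation.Nullary using (yes; no; does; ¬_; contradiction)
  open import Relation.Nullary.Decidable using (_×-dec_; dec-true)
  open import Relation.Unary using (Pred; Decidable)
  open import Relation.Binary.PropositionalEquality

  private variable
    ℓ : Level
    n : ℕ

  ∣p∪q∣+∣p∩q∣≡∣p∣+∣q∣ : (p q : Subset n) → ∣ p ∪ q ∣ + ∣ p ∩ q ∣ ≡ ∣ p ∣ + ∣ q ∣
  ∣p∪q∣+∣p∩q∣≡∣p∣+∣q∣ [] [] = refl
  ∣p∪q∣+∣p∩q∣≡∣p∣+∣q∣ (outside ∷ p) (outside ∷ q) = ∣p∪q∣+∣p∩q∣≡∣p∣+∣q∣ p q
  ∣p∪q∣+∣p∩q∣≡∣p∣+∣q∣ (inside ∷ p) (outside ∷ q) = cong suc (∣p∪q∣+∣p∩q∣≡∣p∣+∣q∣ p q)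
  ∣p∪q∣+∣p∩q∣≡∣p∣+∣q∣ (outside ∷ p) (inside ∷ q) =
    trans (cong suc (∣p∪q∣+∣p∩q∣≡∣p∣+∣q∣ p q)) (sym (+-suc ∣ p ∣ ∣ q ∣))
  ∣p∪q∣+∣p∩q∣≡∣p∣+∣q∣ (inside ∷ p) (inside ∷ q) = cong suc (begin
    ∣ p ∪ q ∣ + suc ∣ p ∩ q ∣   ≡⟨ +-suc ∣ p ∪ q ∣ ∣ p ∩ q ∣ ⟩
    suc (∣ p ∪ q ∣ + ∣ p ∩ q ∣) ≡⟨ cong suc (∣p∪q∣+∣p∩q∣≡∣p∣+∣q∣ p q) ⟩
    suc (∣ p ∣ + ∣ q ∣)         ≡⟨ +-suc ∣ p ∣ ∣ q ∣ ⟨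
    ∣ p ∣ + suc ∣ q ∣           ∎)
    where open ≡-Reasoning

  ∣p∪q∣≤∣p∣+∣q∣ : (p q : Subset n) → ∣ p ∪ q ∣ ≤ ∣ p ∣ + ∣ q ∣
  ∣p∪q∣≤∣p∣+∣q∣ p q = subst (∣ p ∪ q ∣ ≤_) (∣p∪q∣+∣p∩q∣≡∣p∣+∣q∣ p q) (m≤m+n ∣ p ∪ q ∣ ∣ p ∩ q ∣)

  Empty⇒∣p∣≡0 : {p : Subset n} → Empty p → ∣ p ∣ ≡ 0
  Empty⇒∣p∣≡0 {n} empty = trans (cong ∣_∣ (Empty-unique empty)) (∣⊥∣≡0 n)

  0<∣p∣⇒Nonempty : {p : Subset n} → 0 < ∣ p ∣ → Nonempty p
  0<∣p∣⇒Nonempty {p = p} 0<∣p∣ with nonempty? p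
  ... | yes ne = ne
  ... | no empty = contradiction (Empty⇒∣p∣≡0 empty) (>⇒≢ 0<∣p∣)

  Nonempty⇒0<∣p∣ : {p : Subset n} → Nonempty p → 0 < ∣ p ∣
  Nonempty⇒0<∣p∣ (x , x∈p) = ≤-<-trans z≤n (x∈p⇒∣p-x∣<∣p∣ x∈p)

  disjoint⇒∣p∣+∣q∣≡∣p∪q∣ : (p q : Subset n) → (∀ {x} → x ∈ p → x ∉ q) → ∣ p ∣ + ∣ q ∣ ≡ ∣ p ∪ q ∣
  disjoint⇒∣p∣+∣q∣≡∣p∪q∣ p q disjoint = begin
    ∣ p ∣ + ∣ q ∣             ≡⟨ ∣p∪q∣+∣p∩q∣≡∣p∣+∣q∣ p q ⟨
    ∣ p ∪ q ∣ + ∣ p ∩ q ∣     ≡⟨ cong (∣ p ∪ q ∣ +_) (Empty⇒∣p∣≡0 p∩q-empty) ⟩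
    ∣ p ∪ q ∣ + 0             ≡⟨ +-identityʳ ∣ p ∪ q ∣ ⟩
    ∣ p ∪ q ∣                 ∎
    where
    open ≡-Reasoning
    p∩q-empty : Empty (p ∩ q)
    p∩q-empty (_ , x∈p∩q) = uncurry disjoint (x∈p∩q⁻ p q x∈p∩q)

  x∈p─q⇒x∉q : ∀ {x : Fin n} (p q : Subset n) → x ∈ p ─ q → x ∉ q
  x∈p─q⇒x∉q (_ ∷ p) (_ ∷ q) (there x∈p─q) (there x∈q) = x∈p─q⇒x∉q p q x∈p─q x∈q

  ∪-⊆ : {p q r : Subset n} → p ⊆ r → q ⊆ r → p ∪ q ⊆ r
  ∪-⊆ {p = p} {q} p⊆r q⊆r x∈p∪q with x∈p∪q⁻ p q x∈p∪q
  ... | inj₁ x∈p = p⊆r x∈p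
  ... | inj₂ x∈q = q⊆r x∈q

  toSubset : {P : Pred (Fin n) ℓ} → Decidable P → Subset n
  toSubset P? = tabulate (does ∘ P?)

  ∈-toSubset⁺ : {P : Pred (Fin n) ℓ} (P? : Decidable P) {x : Fin n} → P x → x ∈ toSubset P?
  ∈-toSubset⁺ P? {x} px = lookup⇒[]= x _ (trans (lookup∘tabulate (does ∘ P?) x) (dec-true (P? x) px))

  ∈-toSubset⁻ : {P : Pred (Fin n) ℓ} (P? : Decidable P) {x : Fin n} → x ∈ toSubset P? → P x
  ∈-toSubset⁻ P? {x} x∈ with P? x | trans (sym (lookup∘tabulate (does ∘ P?) x)) ([]=⇒lookup x∈)
  ... | yes px | _ = px

  InNeighbour : Digraph n → Subset n → Pred (Fin n) _
  InNeighbour D S u = ∃ λ v → v ∈ S × Arc D u v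

  inNeighbour? : (D : Digraph n) (S : Subset n) → Decidable (InNeighbour D S)
  inNeighbour? D S u = any? λ v → v ∈? S ×-dec D u v Bool.≟ true

  inNeighbours : Digraph n → Subset n → Subset n
  inNeighbours D S = toSubset (inNeighbour? D S)

  ∈-inNeighbours⁺ : ∀ {D : Digraph n} {S u v} → v ∈ S → Arc D u v → u ∈ inNeighbours D S
  ∈-inNeighbours⁺ {D = D} {S} v∈S uv = ∈-toSubset⁺ (inNeighbour? D S) (_ , v∈S , uv)

  ∈-inNeighbours⁻ : ∀ {D : Digraph n} {S u} → u ∈ inNeighbours D S → InNeighbour D S u
  ∈-inNeighbours⁻ {D = D} {S} = ∈-toSubset⁻ (inNeighbour? D S)

  inNeighbours-∪ : ∀ {D : Digraph n} S T → inNeighbours D (S ∪ T) ⊆ inNeighbours D S ∪ inNeighbours D T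
  inNeighbours-∪ S T u∈ with ∈-inNeighbours⁻ u∈
  ... | v , v∈S∪T , uv with x∈p∪q⁻ S T v∈S∪T
  ...   | inj₁ v∈S = x∈p∪q⁺ (inj₁ (∈-inNeighbours⁺ v∈S uv))
  ...   | inj₂ v∈T = x∈p∪q⁺ (inj₂ (∈-inNeighbours⁺ v∈T uv))

  withoutArcsFrom : Digraph n → Subset n → Digraph n
  withoutArcsFrom D P u v = if does (u ∈? P) then false else D u v

  withoutArcsFrom-arc⁺ : ∀ {D : Digraph n} {P u v} → Arc D u v → u ∉ P → Arc (withoutArcsFrom D P) u v
  withoutArcsFrom-arc⁺ {P = P} {u} uv u∉P with u ∈? P
  ... | yes u∈P = contradiction u∈P u∉P
  ... | no _ = uv

  withoutArcsFrom-arc⁻ : ∀ {D : Digraph n} {P u v} → Arc (withoutArcsFrom D P) u v → Arc D u v × u ∉ P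
  withoutArcsFrom-arc⁻ {P = P} {u} uv with u ∈? P
  ... | no u∉P = uv , u∉P

  inNeighbours-withoutArcsFrom : ∀ {D : Digraph n} P S →
    inNeighbours D S ⊆ inNeighbours (withoutArcsFrom D P) S ∪ P
  inNeighbours-withoutArcsFrom {D = D} P S {u} u∈ with u ∈? P | ∈-inNeighbours⁻ u∈
  ... | yes u∈P | _ = q⊆p∪q _ P u∈P
  ... | no u∉P | v , v∈S , uv = p⊆p∪q P (∈-inNeighbours⁺ v∈S (withoutArcsFrom-arc⁺ {D = D} uv u∉P))

  HallCondition : Digraph n → Subset n → Set
  HallCondition D T = ∀ S → S ⊆ T → ∣ S ∣ ≤ ∣ inNeighbours D S ∣

  HallCondition⇒inNeighbour : ∀ {D : Digraph n} {T v} → HallCondition D T → v ∈ T → ∃ λ u → Arc D u v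
  HallCondition⇒inNeighbour {D = D} {T} {v} hallT v∈T =
    let u , u∈N[v] = 0<∣p∣⇒Nonempty ∣N[v]∣≥1
        w , w∈⁅v⁆ , uw = ∈-inNeighbours⁻ u∈N[v]
    in u , subst (Arc D u) (x∈⁅y⁆⇒x≡y v w∈⁅v⁆) uw
    where
    ⁅v⁆⊆T : ⁅ v ⁆ ⊆ T
    ⁅v⁆⊆T w∈⁅v⁆ = subst (_∈ T) (sym (x∈⁅y⁆⇒x≡y v w∈⁅v⁆)) v∈T
    ∣N[v]∣≥1 : 1 ≤ ∣ inNeighbours D ⁅ v ⁆ ∣
    ∣N[v]∣≥1 = subst (_≤ ∣ inNeighbours D ⁅ v ⁆ ∣) (∣⁅x⁆∣≡1 v) (hallT ⁅ v ⁆ ⁅v⁆⊆T)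

  record Matching (D : Digraph n) (T : Subset n) : Set where
    field
      partner : Fin n → Fin n
      arc : ∀ {v} → v ∈ T → Arc D (partner v) v
      injective : ∀ {v w} → v ∈ T → w ∈ T → partner v ≡ partner w → v ≡ w

  Empty⇒Matching : ∀ {D : Digraph n} {T} → Empty T → Matching D T
  Empty⇒Matching empty = record
    { partner = id
    ; arc = λ v∈T → contradiction (_ , v∈T) empty
    ; injective = λ v∈T _ _ → contradiction (_ , v∈T) empty
    }

  Matching-⁅⁆ : ∀ {D : Digraph n} {u v} → Arc D u v → Matching D ⁅ v ⁆
  Matching-⁅⁆ {D = D} {u} {v} uv = record
    { partner = λ _ → u
    ; arc = λ w∈⁅v⁆ → subst (Arc D u) (sym (x∈⁅y⁆⇒x≡y v w∈⁅v⁆)) uv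
    ; injective = λ w∈⁅v⁆ w′∈⁅v⁆ _ → trans (x∈⁅y⁆⇒x≡y v w∈⁅v⁆) (sym (x∈⁅y⁆⇒x≡y v w′∈⁅v⁆))
    }

  glue : ∀ {D : Digraph n} {S U T P} → T ⊆ S ∪ U → (M : Matching D S) →
         (∀ {v} → v ∈ S → Matching.partner M v ∈ P) →
         Matching (withoutArcsFrom D P) U → Matching D T
  glue {n} {D} {S} {U} {T} {P} T⊆S∪U M M⊆P M′ =
    record { partner = partner ; arc = arc ; injective = injective }
    where
    module M = Matching M
    module M′ = Matching M′

    partner : Fin n → Fin n
    partner v = if does (v ∈? S) then M.partner v else M′.partner v

    ∈U : ∀ {v} → v ∈ T → v ∉ S → v ∈ U
    ∈U v∈T v∉S with x∈p∪q⁻ S U (T⊆S∪U v∈T)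
    ... | inj₁ v∈S = contradiction v∈S v∉S
    ... | inj₂ v∈U = v∈U

    arc′ : ∀ {v} (v∈U : v ∈ U) → Arc D (M′.partner v) v × M′.partner v ∉ P
    arc′ v∈U = withoutArcsFrom-arc⁻ {D = D} {P} (M′.arc v∈U)

    arc : ∀ {v} → v ∈ T → Arc D (partner v) v
    arc {v} v∈T with v ∈? S
    ... | yes v∈S = M.arc v∈S
    ... | no v∉S = proj₁ (arc′ (∈U v∈T v∉S))

    injective : ∀ {v w} → v ∈ T → w ∈ T → partner v ≡ partner w → v ≡ w
    injective {v} {w} v∈T w∈T eq with v ∈? S | w ∈? S
    ... | yes v∈S | yes w∈S = M.injective v∈S w∈S eq
    ... | no v∉S | no w∉S = M′.injective (∈U v∈T v∉S) (∈U w∈T w∉S) eq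
    ... | yes v∈S | no w∉S = contradiction (subst (_∈ P) eq (M⊆P v∈S)) (proj₂ (arc′ (∈U w∈T w∉S)))
    ... | no v∉S | yes w∈S = contradiction (subst (_∈ P) (sym eq) (M⊆P w∈S)) (proj₂ (arc′ (∈U v∈T v∉S)))

  module _ {n : ℕ} where

    HallBelow : ℕ → Set
    HallBelow k = ∀ (D : Digraph n) T → ∣ T ∣ ≤ k → HallCondition D T → Matching D T

    Critical : Digraph n → Subset n → Subset n → Set
    Critical D T S = S ⊆ T × Nonempty S × ∣ S ∣ < ∣ T ∣ × ∣ inNeighbours D S ∣ ≤ ∣ S ∣

    critical? : (D : Digraph n) (T : Subset n) → Decidable (Critical D T)
    critical? D T S = S ⊆? T ×-dec nonempty? S ×-dec ∣ S ∣ <? ∣ T ∣ ×-dec ∣ inNeighbours D S ∣ ≤? ∣ S ∣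

    hall-critical : ∀ {k D T S} → HallBelow k → ∣ T ∣ ≤ suc k → HallCondition D T → Critical D T S →
                    Matching D T
    hall-critical {k} {D} {T} {S} hall-k ∣T∣≤1+k hallT (S⊆T , S≠∅ , ∣S∣<∣T∣ , ∣P∣≤∣S∣) =
      glue T⊆S∪T─S matchS (λ v∈S → ∈-inNeighbours⁺ v∈S (Matching.arc matchS v∈S))
        (hall-k D′ (T ─ S) ∣T─S∣≤k hallRest)
      where
      P : Subset n
      P = inNeighbours D S
      D′ : Digraph n
      D′ = withoutArcsFrom D P
      open ≤-Reasoning

      T⊆S∪T─S : T ⊆ S ∪ (T ─ S)
      T⊆S∪T─S {v} v∈T with v ∈? S
      ... | yes v∈S = p⊆p∪q _ v∈S
      ... | no v∉S = q⊆p∪q S _ (x∈p∧x∉q⇒x∈p─q v∈T v∉S)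

      matchS : Matching D S
      matchS = hall-k D S (≤-pred (≤-trans ∣S∣<∣T∣ ∣T∣≤1+k)) (λ W W⊆S → hallT W (⊆-trans W⊆S S⊆T))

      ∣T─S∣≤k : ∣ T ─ S ∣ ≤ k
      ∣T─S∣≤k = ≤-pred (begin
        suc ∣ T ─ S ∣        ≡⟨ +-comm 1 ∣ T ─ S ∣ ⟩
        ∣ T ─ S ∣ + 1        ≤⟨ +-monoʳ-≤ ∣ T ─ S ∣ (Nonempty⇒0<∣p∣ S≠∅) ⟩
        ∣ T ─ S ∣ + ∣ S ∣    ≡⟨ disjoint⇒∣p∣+∣q∣≡∣p∪q∣ (T ─ S) S (x∈p─q⇒x∉q T S) ⟩
        ∣ (T ─ S) ∪ S ∣      ≤⟨ p⊆q⇒∣p∣≤∣q∣ (∪-⊆ (p─q⊆p T S) S⊆T) ⟩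
        ∣ T ∣                ≤⟨ ∣T∣≤1+k ⟩
        suc k                ∎)

      hallRest : HallCondition D′ (T ─ S)
      hallRest W W⊆T─S = +-cancelʳ-≤ ∣ S ∣ _ _ (begin
        ∣ W ∣ + ∣ S ∣                  ≡⟨ disjoint⇒∣p∣+∣q∣≡∣p∪q∣ W S (x∈p─q⇒x∉q T S ∘ W⊆T─S) ⟩
        ∣ W ∪ S ∣                      ≤⟨ hallT (W ∪ S) (∪-⊆ (⊆-trans W⊆T─S (p─q⊆p T S)) S⊆T) ⟩
        ∣ inNeighbours D (W ∪ S) ∣     ≤⟨ p⊆q⇒∣p∣≤∣q∣ N[W∪S]⊆ ⟩
        ∣ inNeighbours D′ W ∪ P ∣      ≤⟨ ∣p∪q∣≤∣p∣+∣q∣ (inNeighbours D′ W) P ⟩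
        ∣ inNeighbours D′ W ∣ + ∣ P ∣  ≤⟨ +-monoʳ-≤ _ ∣P∣≤∣S∣ ⟩
        ∣ inNeighbours D′ W ∣ + ∣ S ∣  ∎)
        where
        N[W∪S]⊆ : inNeighbours D (W ∪ S) ⊆ inNeighbours D′ W ∪ P
        N[W∪S]⊆ u∈ with x∈p∪q⁻ _ _ (inNeighbours-∪ W S u∈)
        ... | inj₁ u∈N[W] = inNeighbours-withoutArcsFrom {D = D} P W u∈N[W]
        ... | inj₂ u∈P = q⊆p∪q _ P u∈P

    hall-noncritical : ∀ {k D T v} → HallBelow k → ∣ T ∣ ≤ suc k → HallCondition D T → v ∈ T →
                       (∀ S → ¬ Critical D T S) → Matching D T
    hall-noncritical {k} {D} {T} {v} hall-k ∣T∣≤1+k hallT v∈T noCritical =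
      glue T⊆⁅v⁆∪T-v (Matching-⁅⁆ u₀v) (λ _ → x∈⁅x⁆ u₀) (hall-k D′ (T - v) ∣T-v∣≤k hallRest)
      where
      open ≤-Reasoning

      u₀ : Fin n
      u₀ = proj₁ (HallCondition⇒inNeighbour hallT v∈T)

      u₀v : Arc D u₀ v
      u₀v = proj₂ (HallCondition⇒inNeighbour hallT v∈T)

      D′ : Digraph n
      D′ = withoutArcsFrom D ⁅ u₀ ⁆

      T⊆⁅v⁆∪T-v : T ⊆ ⁅ v ⁆ ∪ (T - v)
      T⊆⁅v⁆∪T-v {w} w∈T with w ≟ v
      ... | yes refl = p⊆p∪q _ (x∈⁅x⁆ v)
      ... | no w≢v = q⊆p∪q ⁅ v ⁆ _ (x∈p∧x≢y⇒x∈p-y w∈T w≢v)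

      ∣T-v∣≤k : ∣ T - v ∣ ≤ k
      ∣T-v∣≤k = ≤-pred (≤-trans (x∈p⇒∣p-x∣<∣p∣ v∈T) ∣T∣≤1+k)

      hallRest : HallCondition D′ (T - v)
      hallRest W W⊆T-v with nonempty? W
      ... | no empty = subst (_≤ ∣ inNeighbours D′ W ∣) (sym (Empty⇒∣p∣≡0 empty)) z≤n
      ... | yes W≠∅ = +-cancelʳ-≤ 1 _ _ (begin
        ∣ W ∣ + 1                          ≡⟨ +-comm ∣ W ∣ 1 ⟩
        suc ∣ W ∣                          ≤⟨ ∣W∣<∣N[W]∣ ⟩
        ∣ inNeighbours D W ∣               ≤⟨ p⊆q⇒∣p∣≤∣q∣ (inNeighbours-withoutArcsFrom {D = D} ⁅ u₀ ⁆ W) ⟩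
        ∣ inNeighbours D′ W ∪ ⁅ u₀ ⁆ ∣     ≤⟨ ∣p∪q∣≤∣p∣+∣q∣ (inNeighbours D′ W) ⁅ u₀ ⁆ ⟩
        ∣ inNeighbours D′ W ∣ + ∣ ⁅ u₀ ⁆ ∣ ≡⟨ cong (∣ inNeighbours D′ W ∣ +_) (∣⁅x⁆∣≡1 u₀) ⟩
        ∣ inNeighbours D′ W ∣ + 1          ∎)
        where
        W⊆T : W ⊆ T
        W⊆T = ⊆-trans W⊆T-v (p─q⊆p T ⁅ v ⁆)
        ∣W∣<∣T∣ : ∣ W ∣ < ∣ T ∣
        ∣W∣<∣T∣ = ≤-<-trans (p⊆q⇒∣p∣≤∣q∣ W⊆T-v) (x∈p⇒∣p-x∣<∣p∣ v∈T)
        ∣W∣<∣N[W]∣ : ∣ W ∣ < ∣ inNeighbours D W ∣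
        ∣W∣<∣N[W]∣ = ≰⇒> λ ∣N[W]∣≤∣W∣ → noCritical W (W⊆T , W≠∅ , ∣W∣<∣T∣ , ∣N[W]∣≤∣W∣)

    hall-≤ : ∀ k → HallBelow k
    hall-≤ k D T ∣T∣≤k hallT with nonempty? T
    ... | no empty = Empty⇒Matching empty
    hall-≤ zero D T ∣T∣≤0 hallT | yes T≠∅ = contradiction ∣T∣≤0 (<⇒≱ (Nonempty⇒0<∣p∣ T≠∅))
    hall-≤ (suc k) D T ∣T∣≤1+k hallT | yes (v , v∈T) with anySubset? (critical? D T)
    ... | yes (S , critical) = hall-critical (hall-≤ k) ∣T∣≤1+k hallT critical
    ... | no noCritical = hall-noncritical (hall-≤ k) ∣T∣≤1+k hallT v∈T (λ S c → noCritical (S , c))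

    hall : ∀ {D : Digraph n} {T} → HallCondition D T → Matching D T
    hall {D} {T} = hall-≤ ∣ T ∣ D T ≤-refl

module CycleCovers where

  open import Data.Nat using (ℕ; zero; suc; _+_; _∸_; _<_; _≤_; _<?_; s≤s)
  open import Data.Nat.Properties
    using (+-identityʳ; m+[n∸m]≡n; m∸n+n≡m; m∸n≤m; n<1+n; 1+n≰n; m<n⇒0<n∸m; <⇒≤; ≤-<-trans; m≤n⇒m<n∨m≡n)
  open import Data.Bool using (if_then_else_)
  open import Data.Fin using (Fin; zero; suc; toℕ; punchOut)
  import Data.Fin as Fin
  open import Data.Fin.Properties
    using (_≟_; _≤?_; any?; ≤-antisym; ≤-totalOrder; pigeonhole; injective⇒≤; punchOut-injective)
  open import Data.List using (List; []; _∷_; _++_; [_]; lookup; map; filter; allFin; applyUpTo)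
  open import Data.List.Membership.Propositional using (_∈_)
  open import Data.List.Membership.Propositional.Properties
    using (∈-++⁻; ∈-lookup; ∈-applyUpTo⁺; ∈-applyUpTo⁻; ∈-map⁺; ∈-map⁻; ∈-filter⁺; ∈-allFin)
  open import Data.List.Relation.Unary.Any as Any using (Any; here; there)
  open import Data.List.Relation.Unary.Any.Properties using (lookup-index)
  open import Data.List.Relation.Unary.All as All using (All; []; _∷_)
  import Data.List.Relation.Unary.All.Properties as All
  open import Data.List.Relation.Unary.AllPairs using (AllPairs; []; _∷_)
  open import Data.List.Relation.Unary.Unique.Propositional using (Unique)
  import Data.List.Relation.Unary.Unique.Propositional.Properties as Unique
  open import Data.List.Relation.Binary.Disjoint.Propositional using (Disjoint)
  import Data.List.Relation.Binary.Disjoint.Propositional.Properties as Disjoint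
  import Data.List.Extrema
  open import Data.Product using (Σ; ∃; _×_; _,_; proj₁; proj₂)
  open import Data.Sum using (inj₁; inj₂)
  open import Data.Empty using (⊥; ⊥-elim)
  open import Function using (id; _∘_)
  open import Function.Definitions using (Injective; StrictlySurjective)
  open import Level using (Level)
  open import Relation.Nullary using (¬_; yes; no; does; contradiction)
  open import Relation.Nullary.Decidable using (_×-dec_)
  open import Relation.Unary using (Pred; Decidable)
  open import Relation.Binary using (Rel; Symmetric)
  open import Relation.Binary.PropositionalEquality hiding ([_])

  private variable
    ℓ : Level
    k n : ℕ

  Fin-injective⇒strictlySurjective : {f : Fin k → Fin k} → Injective _≡_ _≡_ f → StrictlySurjective _≡_ f
  Fin-injective⇒strictlySurjective {suc k} {f} f-injective y with any? (λ x → f x ≟ y)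
  ... | yes found = found
  ... | no ¬found = contradiction (injective⇒≤ f′-injective) 1+n≰n
    where
    y≢f : ∀ x → y ≢ f x
    y≢f x y≡fx = ¬found (x , sym y≡fx)
    f′ : Fin (suc k) → Fin k
    f′ x = punchOut (y≢f x)
    f′-injective : Injective _≡_ _≡_ f′
    f′-injective eq = f-injective (punchOut-injective (y≢f _) (y≢f _) eq)

  least-witness : {P : Pred ℕ ℓ} → Decidable P → ∀ {d} → P d → ∃ λ k → P k × (∀ {j} → j < k → ¬ P j)
  least-witness P? {zero} p0 = 0 , p0 , λ ()
  least-witness P? {suc d} pd with P? 0
  ... | yes p0 = 0 , p0 , λ ()
  ... | no ¬p0 with least-witness (λ j → P? (suc j)) pd
  ...   | k , pk , below = suc k , pk , λ { {zero} _ → ¬p0 ; {suc j} (s≤s j<k) → below j<k }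

  applyUpTo-suc : ∀ {A : Set} (f : ℕ → A) m → applyUpTo f (suc m) ≡ applyUpTo f m ++ [ f m ]
  applyUpTo-suc f zero = refl
  applyUpTo-suc f (suc m) = cong (f 0 ∷_) (applyUpTo-suc (f ∘ suc) m)

  Unique-rotate : ∀ {A : Set} {a : A} {l} → Unique (a ∷ l) → Unique (l ++ [ a ])
  Unique-rotate {l = []} _ = [] ∷ []
  Unique-rotate {l = b ∷ l} ((a≢b ∷ a∉l) ∷ b∉l ∷ unique) =
    All.++⁺ b∉l ((λ b≡a → a≢b (sym b≡a)) ∷ []) ∷ Unique-rotate (a∉l ∷ unique)

  AllPairs-lookup : ∀ {A : Set} {R : Rel A ℓ} → Symmetric R → ∀ {xs} → AllPairs R xs →
                    ∀ {i j} → i ≢ j → R (lookup xs i) (lookup xs j)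
  AllPairs-lookup sym (r ∷ rs) {zero} {zero} i≢j = contradiction refl i≢j
  AllPairs-lookup sym (r ∷ rs) {zero} {suc j} _ = All.lookup r (∈-lookup j)
  AllPairs-lookup sym (r ∷ rs) {suc i} {zero} _ = sym (All.lookup r (∈-lookup i))
  AllPairs-lookup sym (r ∷ rs) {suc i} {suc j} i≢j = AllPairs-lookup sym rs (λ i≡j → i≢j (cong suc i≡j))

  transpose : Digraph n → Digraph n
  transpose D u v = D v u

  -- Injective maps of Fin n are exactly its permutations.
  ArcPermutation : Digraph n → Set
  ArcPermutation {n} D = Σ (Fin n → Fin n) λ s → Injective _≡_ _≡_ s × (∀ v → Arc D v (s v))

  ArcPermutation-transpose : {D : Digraph n} → ArcPermutation D → ArcPermutation (transpose D)
  ArcPermutation-transpose {n} {D} (s , s-injective , s-arc) = s⁻¹ , s⁻¹-injective , s⁻¹-arc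
    where
    s⁻¹ : Fin n → Fin n
    s⁻¹ w = proj₁ (Fin-injective⇒strictlySurjective s-injective w)
    s∘s⁻¹ : ∀ w → s (s⁻¹ w) ≡ w
    s∘s⁻¹ w = proj₂ (Fin-injective⇒strictlySurjective s-injective w)
    s⁻¹-injective : Injective _≡_ _≡_ s⁻¹
    s⁻¹-injective {w} {w′} eq = trans (sym (s∘s⁻¹ w)) (trans (cong s eq) (s∘s⁻¹ w′))
    s⁻¹-arc : ∀ w → Arc D (s⁻¹ w) w
    s⁻¹-arc w = subst (Arc D (s⁻¹ w)) (s∘s⁻¹ w) (s-arc (s⁻¹ w))

  successorIn : List (Fin n) → Fin n → Fin n
  successorIn (a ∷ b ∷ ws) x = if does (x ≟ a) then b else successorIn (b ∷ ws) x
  successorIn _ x = x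

  successorIn-∈ : ∀ a l (z : Fin n) {x} → x ∈ a ∷ l → successorIn (a ∷ l ++ [ z ]) x ∈ l ++ [ z ]
  successorIn-∈ a [] z {x} x∈ with x ≟ a
  ... | yes _ = here refl
  ... | no x≢a = contradiction (Any.tail x≢a x∈) λ ()
  successorIn-∈ a (b ∷ l) z {x} x∈ with x ≟ a
  ... | yes _ = here refl
  ... | no x≢a = there (successorIn-∈ b l z (Any.tail x≢a x∈))

  successorIn-arc : ∀ {D : Digraph n} a l z {x} → Walk D (a ∷ l ++ [ z ]) → x ∈ a ∷ l →
                    Arc D x (successorIn (a ∷ l ++ [ z ]) x)
  successorIn-arc a [] z {x} (az , _) x∈ with x ≟ a
  ... | yes refl = az
  ... | no x≢a = contradiction (Any.tail x≢a x∈) λ ()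
  successorIn-arc a (b ∷ l) z {x} (ab , walk) x∈ with x ≟ a
  ... | yes refl = ab
  ... | no x≢a = successorIn-arc b l z walk (Any.tail x≢a x∈)

  successorIn-injective : ∀ a l (z : Fin n) {x y} → Unique (l ++ [ z ]) → x ∈ a ∷ l → y ∈ a ∷ l →
                          successorIn (a ∷ l ++ [ z ]) x ≡ successorIn (a ∷ l ++ [ z ]) y → x ≡ y
  successorIn-injective a [] z _ (here refl) (here refl) _ = refl
  successorIn-injective a (b ∷ l) z {x} {y} (b∉ ∷ unique) x∈ y∈ eq with x ≟ a | y ≟ a
  ... | yes refl | yes refl = refl
  ... | no x≢a | no y≢a = successorIn-injective b l z unique (Any.tail x≢a x∈) (Any.tail y≢a y∈) eq
  ... | yes refl | no y≢a = ⊥-elim (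
    All.lookup b∉ (subst (_∈ l ++ [ z ]) (sym eq) (successorIn-∈ b l z (Any.tail y≢a y∈))) refl)
  ... | no x≢a | yes refl = ⊥-elim (
    All.lookup b∉ (subst (_∈ l ++ [ z ]) eq (successorIn-∈ b l z (Any.tail x≢a x∈))) refl)

  cycleSuccessor : List (Fin n) → Fin n → Fin n
  cycleSuccessor [] = id
  cycleSuccessor (a ∷ l) = successorIn (a ∷ l ++ [ a ])

  cycleSuccessor-∈ : ∀ (c : List (Fin n)) {x} → x ∈ c → cycleSuccessor c x ∈ c
  cycleSuccessor-∈ (a ∷ l) x∈ with ∈-++⁻ l (successorIn-∈ a l a x∈)
  ... | inj₁ s∈l = there s∈l
  ... | inj₂ (here s≡a) = here s≡a

  module _ {D : Digraph n} where

    cycleSuccessor-arc : ∀ {c} → IsCycle D c → ∀ {x} → x ∈ c → Arc D x (cycleSuccessor c x)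
    cycleSuccessor-arc {a ∷ l} (_ , walk) = successorIn-arc a l a walk

    cycleSuccessor-injective : ∀ {c} → IsCycle D c → ∀ {x y} → x ∈ c → y ∈ c →
                               cycleSuccessor c x ≡ cycleSuccessor c y → x ≡ y
    cycleSuccessor-injective {a ∷ l} (unique , _) = successorIn-injective a l a (Unique-rotate unique)

    CycleCover⇒ArcPermutation : CycleCover D → ArcPermutation D
    CycleCover⇒ArcPermutation (cs , cycles , disjoint , covered) = s , s-injective , s-arc
      where
      isCycle : ∀ i → IsCycle D (lookup cs i)
      isCycle i = cycles _ (∈-lookup i)

      s : Fin n → Fin n
      s v = cycleSuccessor (lookup cs (proj₁ (covered v))) v

      s-arc : ∀ v → Arc D v (s v)
      s-arc v = cycleSuccessor-arc (isCycle (proj₁ (covered v))) (proj₂ (covered v))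

      injective-across : ∀ i j {x y} → x ∈ lookup cs i → y ∈ lookup cs j →
                         cycleSuccessor (lookup cs i) x ≡ cycleSuccessor (lookup cs j) y → x ≡ y
      injective-across i j x∈ y∈ eq with i ≟ j
      ... | yes refl = cycleSuccessor-injective (isCycle i) x∈ y∈ eq
      ... | no i≢j = ⊥-elim (disjoint i j i≢j _ (cycleSuccessor-∈ _ x∈)
                       (subst (_∈ lookup cs j) (sym eq) (cycleSuccessor-∈ _ y∈)))

      s-injective : Injective _≡_ _≡_ s
      s-injective = injective-across _ _ (proj₂ (covered _)) (proj₂ (covered _))

  module _ {D : Digraph n} where

    Walk-applyUpTo : ∀ f → (∀ j → Arc D (f j) (f (suc j))) → ∀ m → Walk D (applyUpTo f m)
    Walk-applyUpTo f arcs zero = _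
    Walk-applyUpTo f arcs (suc zero) = _
    Walk-applyUpTo f arcs (suc (suc m)) = arcs 0 , Walk-applyUpTo (f ∘ suc) (arcs ∘ suc) (suc m)

    applyUpTo-IsCycle : ∀ f m → 0 < m → (∀ {i j} → i < j → j < m → f i ≢ f j) →
                        (∀ j → Arc D (f j) (f (suc j))) → f m ≡ f 0 → IsCycle D (applyUpTo f m)
    applyUpTo-IsCycle f (suc m) _ distinct arcs closed =
      Unique.applyUpTo⁺₁ f (suc m) distinct ,
      subst (Walk D) (trans (applyUpTo-suc f (suc m)) (cong (λ z → applyUpTo f (suc m) ++ [ z ]) closed))
        (Walk-applyUpTo f arcs (suc (suc m)))

  module Orbits {D : Digraph n} (s : Fin n → Fin n) (s-injective : Injective _≡_ _≡_ s)
                (s-arc : ∀ v → Arc D v (s v)) where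

    iter : ℕ → Fin n → Fin n
    iter zero v = v
    iter (suc j) v = s (iter j v)

    iter-+ : ∀ i j v → iter (i + j) v ≡ iter i (iter j v)
    iter-+ zero j v = refl
    iter-+ (suc i) j v = cong s (iter-+ i j v)

    iter-cancelˡ : ∀ c {a b} v → iter (c + a) v ≡ iter (c + b) v → iter a v ≡ iter b v
    iter-cancelˡ zero v eq = eq
    iter-cancelˡ (suc c) v eq = iter-cancelˡ c v (s-injective eq)

    iter-returns : ∀ {i j} v → i ≤ j → iter i v ≡ iter j v → iter (j ∸ i) v ≡ v
    iter-returns {i} {j} v i≤j eq = sym (iter-cancelˡ i v (begin
      iter (i + 0) v        ≡⟨ cong (λ k → iter k v) (+-identityʳ i) ⟩
      iter i v              ≡⟨ eq ⟩
      iter j v              ≡⟨ cong (λ k → iter k v) (m+[n∸m]≡n i≤j) ⟨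
      iter (i + (j ∸ i)) v  ∎))
      where open ≡-Reasoning

    Returns : Fin n → ℕ → Set
    Returns v d = 0 < d × iter d v ≡ v

    returns : ∀ v → ∃ (Returns v)
    returns v with pigeonhole (n<1+n n) (λ i → iter (toℕ i) v)
    ... | i , j , i<j , eq = toℕ j ∸ toℕ i , m<n⇒0<n∸m i<j , iter-returns v (<⇒≤ i<j) eq

    minimalReturn : ∀ v → ∃ λ p → Returns v p × (∀ {j} → j < p → ¬ Returns v j)
    minimalReturn v = least-witness (λ d → 0 <? d ×-dec iter d v ≟ v) (proj₂ (returns v))

    period : Fin n → ℕ
    period v = proj₁ (minimalReturn v)

    0<period : ∀ v → 0 < period v
    0<period v = proj₁ (proj₁ (proj₂ (minimalReturn v)))

    iter-period : ∀ v → iter (period v) v ≡ v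
    iter-period v = proj₂ (proj₁ (proj₂ (minimalReturn v)))

    iter-injective : ∀ v {i j} → i < j → j < period v → iter i v ≢ iter j v
    iter-injective v {i} {j} i<j j<p eq = proj₂ (proj₂ (minimalReturn v))
      (≤-<-trans (m∸n≤m j i) j<p) (m<n⇒0<n∸m i<j , iter-returns v (<⇒≤ i<j) eq)

    orbit : Fin n → List (Fin n)
    orbit v = applyUpTo (λ j → iter j v) (period v)

    orbit-IsCycle : ∀ v → IsCycle D (orbit v)
    orbit-IsCycle v = applyUpTo-IsCycle (λ j → iter j v) (period v) (0<period v)
      (iter-injective v) (λ j → s-arc (iter j v)) (iter-period v)

    ∈-orbit⁻ : ∀ {v w} → w ∈ orbit v → ∃ λ j → j < period v × w ≡ iter j v
    ∈-orbit⁻ {v} = ∈-applyUpTo⁻ (λ j → iter j v)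

    orbit-closed : ∀ {v w} → w ∈ orbit v → s w ∈ orbit v
    orbit-closed {v} w∈ with ∈-orbit⁻ w∈
    ... | j , j<p , refl with m≤n⇒m<n∨m≡n j<p
    ...   | inj₁ 1+j<p = ∈-applyUpTo⁺ (λ j → iter j v) 1+j<p
    ...   | inj₂ 1+j≡p = subst (_∈ orbit v) (sym (trans (cong (λ k → iter k v) 1+j≡p) (iter-period v)))
                           (∈-applyUpTo⁺ (λ j → iter j v) (0<period v))

    ∈-orbit⁺ : ∀ j v → iter j v ∈ orbit v
    ∈-orbit⁺ zero v = ∈-applyUpTo⁺ (λ j → iter j v) (0<period v)
    ∈-orbit⁺ (suc j) v = orbit-closed (∈-orbit⁺ j v)

    orbit-⊆ : ∀ {v w u} → w ∈ orbit v → u ∈ orbit w → u ∈ orbit v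
    orbit-⊆ {v} w∈ u∈ with ∈-orbit⁻ w∈ | ∈-orbit⁻ u∈
    ... | j , _ , refl | i , _ , refl = subst (_∈ orbit v) (iter-+ i j v) (∈-orbit⁺ (i + j) v)

    orbit-sym : ∀ {v w} → w ∈ orbit v → v ∈ orbit w
    orbit-sym {v} w∈ with ∈-orbit⁻ w∈
    ... | j , j<p , refl = subst (_∈ orbit (iter j v)) v≡ (∈-orbit⁺ (period v ∸ j) (iter j v))
      where
      v≡ : iter (period v ∸ j) (iter j v) ≡ v
      v≡ = trans (sym (iter-+ (period v ∸ j) j v))
             (trans (cong (λ k → iter k v) (m∸n+n≡m (<⇒≤ j<p))) (iter-period v))

    IsLeast : Fin n → Set
    IsLeast v = All (v Fin.≤_) (orbit v)

    isLeast? : Decidable IsLeast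
    isLeast? v = All.all? (v ≤?_) (orbit v)

    -- each orbit is listed once, from its least vertex
    leaders : List (Fin n)
    leaders = filter isLeast? (allFin n)

    orbits-disjoint : ∀ {a b} → IsLeast a → IsLeast b → a ≢ b → Disjoint (orbit a) (orbit b)
    orbits-disjoint least-a least-b a≢b (w∈a , w∈b) = a≢b (≤-antisym
      (All.lookup least-a (orbit-⊆ w∈a (orbit-sym w∈b)))
      (All.lookup least-b (orbit-⊆ w∈b (orbit-sym w∈a))))

    leader : ∀ w → ∃ λ r → IsLeast r × w ∈ orbit r
    leader w = r , least , orbit-sym r∈
      where
      open Data.List.Extrema (≤-totalOrder n) using (min; min≤xs; argmin-all)
      r : Fin n
      r = min w (orbit w)
      r∈ : r ∈ orbit w
      r∈ = argmin-all id (∈-orbit⁺ 0 w) (All.tabulate id)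
      least : IsLeast r
      least = All.tabulate λ z∈ → All.lookup (min≤xs w (orbit w)) (orbit-⊆ r∈ z∈)

    pairwiseDisjoint : ∀ {vs} → Unique vs → All IsLeast vs → AllPairs Disjoint (map orbit vs)
    pairwiseDisjoint [] [] = []
    pairwiseDisjoint (v∉ ∷ unique) (least ∷ leasts) =
      All.map⁺ (All.zipWith (λ (v≢w , least′) {_} → orbits-disjoint least least′ v≢w) (v∉ , leasts))
      ∷ pairwiseDisjoint unique leasts

    cycleCover : CycleCover D
    cycleCover = map orbit leaders , cycles , disjoint , covered
      where
      cycles : ∀ c → c ∈ map orbit leaders → IsCycle D c
      cycles c c∈ with ∈-map⁻ orbit c∈
      ... | r , _ , refl = orbit-IsCycle r
      disjoint : ∀ i j → i ≢ j → ∀ v → v ∈ lookup (map orbit leaders) i → v ∈ lookup (map orbit leaders) j → ⊥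
      disjoint i j i≢j v v∈i v∈j = AllPairs-lookup Disjoint.sym
        (pairwiseDisjoint (Unique.filter⁺ isLeast? (Unique.allFin⁺ n)) (All.all-filter isLeast? (allFin n)))
        i≢j (v∈i , v∈j)
      covered : ∀ v → ∃ λ i → v ∈ lookup (map orbit leaders) i
      covered v with leader v
      ... | r , least , v∈ = Any.index v∈cs , lookup-index v∈cs
        where
        v∈cs : Any (v ∈_) (map orbit leaders)
        v∈cs = Any.map (λ { refl → v∈ }) (∈-map⁺ orbit (∈-filter⁺ isLeast? (∈-allFin r) least))

  ArcPermutation⇒CycleCover : {D : Digraph n} → ArcPermutation D → CycleCover D
  ArcPermutation⇒CycleCover (s , s-injective , s-arc) = Orbits.cycleCover s s-injective s-arc

module Configurations where

  open Hall
  open CycleCovers using (Fin-injective⇒strictlySurjective; transpose; ArcPermutation)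
  open import Data.Nat using (ℕ; _≤_; _^_; s≤s)
  open import Data.Nat.Properties using (≮⇒≥; <⇒≱; ^-monoʳ-<)
  open import Data.Bool using (true)
  import Data.Bool.Properties as Bool
  open import Data.Fin using (Fin; zero)
  open import Data.Fin.Properties using (_≟_; injective⇒≤)
  open import Data.Fin.Subset using (Subset; inside; outside; ∣_∣; _∈_; ⊤)
  open import Data.Fin.Subset.Properties using (∈⊤)
  open import Data.Vec using (Vec; []; _∷_; here; there; lookup; _[_]≔_)
  open import Data.Vec.Properties using (tabulate∘lookup; tabulate-cong; lookup∘update; lookup∘update′; []≔-lookup)
  open import Data.Vec.Recursive using (Fin[m^n]↔Fin[m]^n)
  open import Data.Vec.Recursive.Properties using (↔Vec)
  open import Data.List using (List; []; _∷_; allFin)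
  import Data.List.Membership.Propositional as List
  open import Data.List.Membership.Propositional.Properties using (∈-allFin)
  open import Data.List.Relation.Unary.Any using (here; there)
  open import Data.Product using (∃; _,_; proj₁; proj₂)
  open import Function using (_∘_; _↔_; Inverse; Injection; Equivalence)
  open import Function.Definitions using (Injective; StrictlySurjective)
  open import Function.Properties.Inverse using (↔-sym; ↔-trans; ↔⇒↣)
  open import Relation.Nullary using (¬_; yes; no; contradiction)
  open import Relation.Binary.PropositionalEquality

  private variable
    a b k n q : ℕ
    A : Set

  Config↔Fin : ∀ q n → Config q n ↔ Fin (q ^ n)
  Config↔Fin q n = ↔-trans (↔-sym (↔Vec n)) (↔-sym (Fin[m^n]↔Fin[m]^n q n))

  ↔Fin-injective⇒strictlySurjective : A ↔ Fin k → {f : A → A} → Injective _≡_ _≡_ f → StrictlySurjective _≡_ f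
  ↔Fin-injective⇒strictlySurjective A↔Fin {f} f-injective y = from (proj₁ found) , to-injective (proj₂ found)
    where
    open Inverse A↔Fin using (to; from)
    to-injective : Injective _≡_ _≡_ to
    to-injective = Injection.injective (↔⇒↣ A↔Fin)
    from-injective : Injective _≡_ _≡_ from
    from-injective = Injection.injective (↔⇒↣ (↔-sym A↔Fin))
    found : ∃ λ i → to (f (from i)) ≡ to y
    found = Fin-injective⇒strictlySurjective {f = to ∘ f ∘ from}
              (λ eq → from-injective (f-injective (to-injective eq))) (to y)

  Config-injective⇒strictlySurjective : {f : Config q n → Config q n} → Injective _≡_ _≡_ f → StrictlySurjective _≡_ f
  Config-injective⇒strictlySurjective {q} {n} = ↔Fin-injective⇒strictlySurjective (Config↔Fin q n)

  Config-injective⇒≤ : 2 ≤ q → {f : Config q b → Config q a} → Injective _≡_ _≡_ f → b ≤ a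
  Config-injective⇒≤ {q} {b} {a} 1<q {f} f-injective =
    ≮⇒≥ λ a<b → <⇒≱ (^-monoʳ-< q 1<q a<b) (injective⇒≤ {f = Inverse.to Fa ∘ f ∘ Inverse.from Fb} injective)
    where
    Fa : Config q a ↔ Fin (q ^ a)
    Fa = Config↔Fin q a
    Fb : Config q b ↔ Fin (q ^ b)
    Fb = Config↔Fin q b
    injective : Injective _≡_ _≡_ (Inverse.to Fa ∘ f ∘ Inverse.from Fb)
    injective eq = Injection.injective (↔⇒↣ (↔-sym Fb)) (f-injective (Injection.injective (↔⇒↣ Fa) eq))

  IG⊆ : (Config q n → Config q n) → Digraph n → Set
  IG⊆ g D = ∀ u v → DependsOn g u v → Arc D u v

  HasIG⇒IG⊆ : ∀ {g : Config q n → Config q n} {D} → HasIG g D → IG⊆ g D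
  HasIG⇒IG⊆ IG[g]=D u v = Equivalence.from (IG[g]=D u v)

  lookup-extensionality : {x y : Vec A n} → (∀ i → lookup x i ≡ lookup y i) → x ≡ y
  lookup-extensionality {x = x} {y} eq =
    trans (sym (tabulate∘lookup x)) (trans (tabulate-cong eq) (tabulate∘lookup y))

  restrict : (S : Subset n) → Vec A n → Vec A ∣ S ∣
  restrict [] [] = []
  restrict (inside ∷ S) (a ∷ x) = a ∷ restrict S x
  restrict (outside ∷ S) (_ ∷ x) = restrict S x

  extend : A → (S : Subset n) → Vec A ∣ S ∣ → Vec A n
  extend d [] w = []
  extend d (inside ∷ S) (a ∷ w) = a ∷ extend d S w
  extend d (outside ∷ S) w = d ∷ extend d S w

  restrict-extend : (d : A) (S : Subset n) (w : Vec A ∣ S ∣) → restrict S (extend d S w) ≡ w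
  restrict-extend d [] [] = refl
  restrict-extend d (inside ∷ S) (a ∷ w) = cong (a ∷_) (restrict-extend d S w)
  restrict-extend d (outside ∷ S) w = restrict-extend d S w

  lookup-extend-restrict : (d : A) (S : Subset n) (x : Vec A n) {v : Fin n} → v ∈ S →
                           lookup (extend d S (restrict S x)) v ≡ lookup x v
  lookup-extend-restrict d (inside ∷ S) (a ∷ x) here = refl
  lookup-extend-restrict d (inside ∷ S) (a ∷ x) (there v∈S) = lookup-extend-restrict d S x v∈S
  lookup-extend-restrict d (outside ∷ S) (a ∷ x) (there v∈S) = lookup-extend-restrict d S x v∈S

  restrict-cong : (S : Subset n) {x y : Vec A n} → (∀ {v} → v ∈ S → lookup x v ≡ lookup y v) →
                  restrict S x ≡ restrict S y
  restrict-cong [] {[]} {[]} _ = refl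
  restrict-cong (inside ∷ S) {_ ∷ x} {_ ∷ y} eq = cong₂ _∷_ (eq here) (restrict-cong S (λ v∈S → eq (there v∈S)))
  restrict-cong (outside ∷ S) {_ ∷ x} {_ ∷ y} eq = restrict-cong S (λ v∈S → eq (there v∈S))

  module _ {g : Config q n → Config q n} {D : Digraph n} (IG[g]⊆D : IG⊆ g D) where

    lookup-update-nonNeighbour : ∀ {u v} x a → ¬ Arc D u v → lookup (g (x [ u ]≔ a)) v ≡ lookup (g x) v
    lookup-update-nonNeighbour {u} {v} x a ¬uv with lookup (g (x [ u ]≔ a)) v ≟ lookup (g x) v
    ... | yes eq = eq
    ... | no neq = contradiction (IG[g]⊆D u v (x , a , neq ∘ sym)) ¬uv

    -- us lists every coordinate where x and y may differ; they are made equal one coordinate at a time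
    lookup-cong-outside : ∀ {v} (us : List (Fin n)) {x y} →
      (∀ {u} → u List.∉ us → lookup x u ≡ lookup y u) →
      (∀ {u} → Arc D u v → lookup x u ≡ lookup y u) → lookup (g x) v ≡ lookup (g y) v
    lookup-cong-outside [] off on = cong (λ z → lookup (g z) _) (lookup-extensionality λ i → off λ ())
    lookup-cong-outside {v} (u ∷ us) {x} {y} off on = trans first-step (lookup-cong-outside us off′ on′)
      where
      x′ : Config q n
      x′ = x [ u ]≔ lookup y u

      x′≗y : ∀ {w} → (w ≢ u → lookup x w ≡ lookup y w) → lookup x′ w ≡ lookup y w
      x′≗y {w} agree with w ≟ u
      ... | yes refl = lookup∘update u x (lookup y u)
      ... | no w≢u = trans (lookup∘update′ w≢u x (lookup y u)) (agree w≢u)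

      off′ : ∀ {w} → w List.∉ us → lookup x′ w ≡ lookup y w
      off′ w∉us = x′≗y λ w≢u → off λ { (here w≡u) → w≢u w≡u ; (there w∈us) → w∉us w∈us }

      on′ : ∀ {w} → Arc D w v → lookup x′ w ≡ lookup y w
      on′ wv = x′≗y λ _ → on wv

      first-step : lookup (g x) v ≡ lookup (g x′) v
      first-step with D u v Bool.≟ true
      ... | yes uv = cong (λ z → lookup (g z) v) (trans (sym ([]≔-lookup x u)) (cong (x [ u ]≔_) (on uv)))
      ... | no ¬uv = sym (lookup-update-nonNeighbour x (lookup y u) ¬uv)

    lookup-cong-inNeighbours : ∀ {v x y} → (∀ {u} → Arc D u v → lookup x u ≡ lookup y u) →
                               lookup (g x) v ≡ lookup (g y) v
    lookup-cong-inNeighbours = lookup-cong-outside (allFin n) (λ u∉ → contradiction (∈-allFin _) u∉)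

    -- An injection [q]^∣S∣ → [q]^∣N⁻(S)∣: prescribe the values of g on S, restrict a preimage to N⁻(S).
    injective⇒HallCondition : 2 ≤ q → Injective _≡_ _≡_ g → ∀ {T} → HallCondition D T
    injective⇒HallCondition 1<q@(s≤s (s≤s _)) g-injective S _ = Config-injective⇒≤ 1<q section-injective
      where
      N : Subset n
      N = inNeighbours D S
      g⁻¹ : Config q n → Config q n
      g⁻¹ y = proj₁ (Config-injective⇒strictlySurjective g-injective y)
      g∘g⁻¹ : ∀ y → g (g⁻¹ y) ≡ y
      g∘g⁻¹ y = proj₂ (Config-injective⇒strictlySurjective g-injective y)
      section : Config q ∣ S ∣ → Config q ∣ N ∣
      section w = restrict N (g⁻¹ (extend zero S w))
      retraction : ∀ w → restrict S (g (extend zero N (section w))) ≡ w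
      retraction w = begin
        restrict S (g (extend zero N (restrict N x))) ≡⟨ restrict-cong S agree ⟩
        restrict S (g x)                              ≡⟨ cong (restrict S) (g∘g⁻¹ (extend zero S w)) ⟩
        restrict S (extend zero S w)                  ≡⟨ restrict-extend zero S w ⟩
        w                                             ∎
        where
        open ≡-Reasoning
        x : Config q n
        x = g⁻¹ (extend zero S w)
        agree : ∀ {v} → v ∈ S → lookup (g (extend zero N (restrict N x))) v ≡ lookup (g x) v
        agree v∈S = lookup-cong-inNeighbours λ uv → lookup-extend-restrict zero N x (∈-inNeighbours⁺ v∈S uv)
      section-injective : Injective _≡_ _≡_ section
      section-injective {w} {w′} eq = trans (sym (retraction w))
        (trans (cong (λ z → restrict S (g (extend zero N z))) eq) (retraction w′))

  injective⇒Matching : ∀ {g : Config q n → Config q n} {D} → 2 ≤ q → IG⊆ g D → Injective _≡_ _≡_ g → Matching D ⊤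
  injective⇒Matching 1<q IG[g]⊆D g-injective = hall (injective⇒HallCondition IG[g]⊆D 1<q g-injective)

  Matching-⊤⇒ArcPermutation : ∀ {D : Digraph n} → Matching D ⊤ → ArcPermutation (transpose D)
  Matching-⊤⇒ArcPermutation M = partner , injective ∈⊤ ∈⊤ , λ v → arc ∈⊤
    where open Matching M

module BijectiveNetworks where

  open Configurations
  open CycleCovers using (Fin-injective⇒strictlySurjective; transpose; ArcPermutation)
  open import Data.Nat using (ℕ; zero; suc; _≤_; s≤s)
  open import Data.Bool using (Bool; true; false; if_then_else_)
  import Data.Bool.Properties as Bool
  open import Data.Fin using (Fin; zero; suc)
  open import Data.Fin.Properties using (_≟_; all?)
  open import Data.Vec using (lookup; tabulate; replicate; _[_]≔_)
  open import Data.Vec.Properties using (lookup∘tabulate; lookup-replicate; lookup∘update; lookup∘update′)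
  open import Data.Product using (Σ; _×_; _,_; proj₁; proj₂)
  open import Function using (case_of_; mk⇔)
  open import Function.Definitions using (Injective)
  open import Function.Consequences.Propositional using (strictlySurjective⇒surjective)
  open import Relation.Nullary using (¬_; Dec; yes; no; does; contradiction)
  open import Relation.Nullary.Decidable using (_→-dec_; ¬?; does-⇔; dec-true; dec-false)
  open import Relation.Binary.PropositionalEquality

  -- Zeros are moved along p, so network x determines the zeros of x, hence which vertices are
  -- armed, hence x.
  module Network {n r : ℕ} (D : Digraph n) (p : Fin n → Fin n)
         (p-injective : Injective _≡_ _≡_ p) (p-arc : ∀ v → Arc D (p v) v) where

    Q : ℕ
    Q = suc (suc (suc r))

    swap₁₂ : Fin Q → Fin Q
    swap₁₂ (suc zero) = suc (suc zero)
    swap₁₂ (suc (suc zero)) = suc zero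
    swap₁₂ a = a

    swap₁₂-involutive : ∀ a → swap₁₂ (swap₁₂ a) ≡ a
    swap₁₂-involutive zero = refl
    swap₁₂-involutive (suc zero) = refl
    swap₁₂-involutive (suc (suc zero)) = refl
    swap₁₂-involutive (suc (suc (suc a))) = refl

    twist : Bool → Fin Q → Fin Q
    twist b a = if b then swap₁₂ a else a

    twist-injective : ∀ b {a a′} → twist b a ≡ twist b a′ → a ≡ a′
    twist-injective false eq = eq
    twist-injective true {a} {a′} eq =
      trans (sym (swap₁₂-involutive a)) (trans (cong swap₁₂ eq) (swap₁₂-involutive a′))

    twist-zero⁻ : ∀ b {a} → twist b a ≡ zero → a ≡ zero
    twist-zero⁻ false eq = eq
    twist-zero⁻ true {zero} _ = refl
    twist-zero⁻ true {suc zero} ()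
    twist-zero⁻ true {suc (suc zero)} ()
    twist-zero⁻ true {suc (suc (suc _))} ()

    twist-zero⁺ : ∀ b → twist b zero ≡ zero
    twist-zero⁺ false = refl
    twist-zero⁺ true = refl

    Armed : Fin n → Config Q n → Set
    Armed v x = ∀ u → Arc D u v → u ≢ p v → lookup x u ≢ zero

    armed? : ∀ v x → Dec (Armed v x)
    armed? v x = all? λ u → (D u v Bool.≟ true) →-dec (¬? (u ≟ p v) →-dec ¬? (lookup x u ≟ zero))

    Armed-zeros : ∀ {v x y} → (∀ u → Arc D u v → u ≢ p v → lookup x u ≡ zero → lookup y u ≡ zero) →
                  Armed v y → Armed v x
    Armed-zeros zeros armed-y u uv u≢pv x≡0 = armed-y u uv u≢pv (zeros u uv u≢pv x≡0)

    does-armed : ∀ v x y → (∀ u → Arc D u v → u ≢ p v → (lookup x u ≡ zero → lookup y u ≡ zero) ×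
                                                            (lookup y u ≡ zero → lookup x u ≡ zero)) →
                 does (armed? v x) ≡ does (armed? v y)
    does-armed v x y zeros = does-⇔ (mk⇔ (Armed-zeros {v} {y} {x} λ u uv u≢pv → proj₂ (zeros u uv u≢pv))
                                          (Armed-zeros {v} {x} {y} λ u uv u≢pv → proj₁ (zeros u uv u≢pv)))
                                     (armed? v x) (armed? v y)

    network : Config Q n → Config Q n
    network x = tabulate λ v → twist (does (armed? v x)) (lookup x (p v))

    lookup-network : ∀ x v → lookup (network x) v ≡ twist (does (armed? v x)) (lookup x (p v))
    lookup-network x v = lookup∘tabulate (λ v → twist (does (armed? v x)) (lookup x (p v))) v

    network-zero⁻ : ∀ x v → lookup (network x) v ≡ zero → lookup x (p v) ≡ zero
    network-zero⁻ x v eq = twist-zero⁻ (does (armed? v x)) (trans (sym (lookup-network x v)) eq)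

    network-zero⁺ : ∀ x v → lookup x (p v) ≡ zero → lookup (network x) v ≡ zero
    network-zero⁺ x v eq = trans (lookup-network x v)
      (trans (cong (twist (does (armed? v x))) eq) (twist-zero⁺ (does (armed? v x))))

    network-injective : Injective _≡_ _≡_ network
    network-injective {x} {y} eq = lookup-extensionality λ w → x≡y-at-p (p⁻¹ w) (p∘p⁻¹ w)
      where
      p⁻¹ : Fin n → Fin n
      p⁻¹ w = proj₁ (Fin-injective⇒strictlySurjective p-injective w)
      p∘p⁻¹ : ∀ w → p (p⁻¹ w) ≡ w
      p∘p⁻¹ w = proj₂ (Fin-injective⇒strictlySurjective p-injective w)

      zeros : ∀ {x y} → network x ≡ network y → ∀ w → lookup x w ≡ zero → lookup y w ≡ zero
      zeros {x} {y} eq w x≡0 = subst (λ u → lookup y u ≡ zero) (p∘p⁻¹ w)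
        (network-zero⁻ y (p⁻¹ w) (subst (λ z → lookup z (p⁻¹ w) ≡ zero) eq
          (network-zero⁺ x (p⁻¹ w) (subst (λ u → lookup x u ≡ zero) (sym (p∘p⁻¹ w)) x≡0))))

      x≡y-at-p : ∀ v {w} → p v ≡ w → lookup x w ≡ lookup y w
      x≡y-at-p v refl = twist-injective (does (armed? v y)) (begin
        twist (does (armed? v y)) (lookup x (p v)) ≡⟨ cong (λ b → twist b (lookup x (p v))) armed≡ ⟨
        twist (does (armed? v x)) (lookup x (p v)) ≡⟨ lookup-network x v ⟨
        lookup (network x) v                       ≡⟨ cong (λ z → lookup z v) eq ⟩
        lookup (network y) v                       ≡⟨ lookup-network y v ⟩
        twist (does (armed? v y)) (lookup y (p v)) ∎)
        where
        open ≡-Reasoning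
        armed≡ : does (armed? v x) ≡ does (armed? v y)
        armed≡ = does-armed v x y (λ u _ _ → zeros {x} {y} eq u , zeros {y} {x} (sym eq) u)

    network-nonNeighbour : ∀ {u v} x a → ¬ Arc D u v → lookup (network x) v ≡ lookup (network (x [ u ]≔ a)) v
    network-nonNeighbour {u} {v} x a ¬uv = begin
      lookup (network x) v                                       ≡⟨ lookup-network x v ⟩
      twist (does (armed? v x)) (lookup x (p v))                 ≡⟨ cong₂ twist armed≡ (sym (lookup∘update′ pv≢u x a)) ⟩
      twist (does (armed? v x′)) (lookup x′ (p v))               ≡⟨ lookup-network x′ v ⟨
      lookup (network x′) v                                      ∎
      where
      open ≡-Reasoning
      x′ : Config Q n
      x′ = x [ u ]≔ a
      pv≢u : p v ≢ u
      pv≢u refl = ¬uv (p-arc v)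
      x′≡x : ∀ {w} → Arc D w v → lookup x′ w ≡ lookup x w
      x′≡x wv = lookup∘update′ (λ { refl → ¬uv wv }) x a
      armed≡ : does (armed? v x) ≡ does (armed? v x′)
      armed≡ = does-armed v x x′ λ w wv _ →
        (λ x≡0 → trans (x′≡x wv) x≡0) , (λ x′≡0 → trans (sym (x′≡x wv)) x′≡0)

    ones : Config Q n
    ones = replicate n (suc zero)

    network-neighbour : ∀ {u v} → Arc D u v → DependsOn network u v
    network-neighbour {u} {v} uv with u ≟ p v
    ... | yes refl = ones , zero , λ eq → contradiction
        (network-zero⁻ ones v (trans eq (network-zero⁺ ones′ v (lookup∘update (p v) ones zero))))
        (λ ones≡0 → case (trans (sym (lookup-replicate (p v) (suc zero))) ones≡0) of λ ())
      where
      ones′ : Config Q n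
      ones′ = ones [ p v ]≔ zero
    ... | no u≢pv = ones , zero , λ eq → case (begin
        suc (suc zero)                                    ≡⟨ cong (twist true) (lookup-replicate (p v) (suc zero)) ⟨
        twist true (lookup ones (p v))                    ≡⟨ cong (λ b → twist b (lookup ones (p v))) armed ⟨
        twist (does (armed? v ones)) (lookup ones (p v))  ≡⟨ lookup-network ones v ⟨
        lookup (network ones) v                           ≡⟨ eq ⟩
        lookup (network ones′) v                          ≡⟨ lookup-network ones′ v ⟩
        twist (does (armed? v ones′)) (lookup ones′ (p v)) ≡⟨ cong (λ b → twist b (lookup ones′ (p v))) unarmed ⟩
        lookup ones′ (p v)                                ≡⟨ lookup∘update′ (λ pv≡u → u≢pv (sym pv≡u)) ones zero ⟩
        lookup ones (p v)                                 ≡⟨ lookup-replicate (p v) (suc zero) ⟩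
        suc zero                                          ∎) of λ ()
      where
      open ≡-Reasoning
      ones′ : Config Q n
      ones′ = ones [ u ]≔ zero
      armed : does (armed? v ones) ≡ true
      armed = dec-true (armed? v ones) λ w _ _ ones≡0 →
        case (trans (sym (lookup-replicate w (suc zero))) ones≡0) of λ ()
      unarmed : does (armed? v ones′) ≡ false
      unarmed = dec-false (armed? v ones′) λ armed′ → armed′ u uv u≢pv (lookup∘update u ones zero)

    network-IG : HasIG network D
    network-IG u v = mk⇔ network-neighbour from
      where
      from : DependsOn network u v → Arc D u v
      from (x , a , ne) with D u v Bool.≟ true
      ... | yes uv = uv
      ... | no ¬uv = contradiction (network-nonNeighbour x a ¬uv) ne

  ArcPermutation⇒bijectiveNetwork : ∀ {n q} {D : Digraph n} → 3 ≤ q → ArcPermutation (transpose D) →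
    Σ (Config q n → Config q n) λ f → InF D q f × IsPermutation f
  ArcPermutation⇒bijectiveNetwork {D = D} (s≤s (s≤s (s≤s _))) (p , p-injective , p-arc) =
    network , network-IG , network-injective ,
    strictlySurjective⇒surjective (Config-injective⇒strictlySurjective network-injective)
    where open Network D p p-injective p-arc

module Schedules where

  open Hall
  open Configurations
  open CycleCovers using (transpose; ArcPermutation)
  open import Data.Nat using (ℕ; _≤_)
  open import Data.Bool using (true; false; if_then_else_)
  open import Data.Fin using (Fin; zero; suc)
  open import Data.Fin.Properties using (_≟_)
  open import Data.Fin.Subset using (Subset; _∈_; _∉_; ⊤)
  open import Data.Fin.Subset.Properties using (_∈?_; ∈⊤)
  open import Data.Vec using (lookup; _[_]≔_)
  open import Data.Vec.Properties using (lookup∘tabulate; lookup∘update′; lookup-replicate; lookup⇒[]=; []=⇒lookup)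
  open import Data.List using ([]; _∷_; length)
  import Data.List as List
  open import Data.Product using (_,_; proj₁; proj₂)
  open import Function using (Equivalence)
  open import Function.Definitions using (Injective)
  open import Relation.Nullary using (yes; no; does; contradiction)
  open import Relation.Binary.PropositionalEquality

  private variable
    n q : ℕ

  lookup-update : (f : Config q n → Config q n) (S : Subset n) (x : Config q n) (v : Fin n) →
                  lookup (update f S x) v ≡ (if lookup S v then lookup (f x) v else lookup x v)
  lookup-update f S x v = lookup∘tabulate (λ v → if lookup S v then lookup (f x) v else lookup x v) v

  blockGraph : Digraph n → Subset n → Digraph n
  blockGraph D S u v = if lookup S v then D u v else does (u ≟ v)

  IG-update : ∀ {D : Digraph n} {f : Config q n → Config q n} → HasIG f D →
              ∀ S → IG⊆ (update f S) (blockGraph D S)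
  IG-update {f = f} IG[f]=D S u v (x , a , ne)
    with lookup S v | lookup-update f S x v | lookup-update f S (x [ u ]≔ a) v
  ... | true | eq₁ | eq₂ = Equivalence.from (IG[f]=D u v) (x , a , λ eq → ne (trans eq₁ (trans eq (sym eq₂))))
  ... | false | eq₁ | eq₂ with u ≟ v
  ...   | yes _ = refl
  ...   | no u≢v =
    contradiction (trans eq₁ (trans (sym (lookup∘update′ (λ v≡u → u≢v (sym v≡u)) x a)) (sym eq₂))) ne

  module BlockMatching {D : Digraph n} {S : Subset n} (M : Matching (blockGraph D S) ⊤) where
    open Matching M

    partner-∉ : ∀ {v} → v ∉ S → partner v ≡ v
    partner-∉ {v} v∉S with lookup S v in S[v] | arc (∈⊤ {x = v})
    ... | true | _ = contradiction (lookup⇒[]= v S S[v]) v∉S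
    ... | false | loop with partner v ≟ v
    ...   | yes eq = eq

    partner-arc : ∀ {v} → v ∈ S → Arc D (partner v) v
    partner-arc {v} v∈S = subst (λ b → (if b then D (partner v) v else does (partner v ≟ v)) ≡ true)
                            ([]=⇒lookup v∈S) (arc ∈⊤)

    partner-∈ : ∀ {v} → v ∈ S → partner v ∈ S
    partner-∈ {v} v∈S with partner v ∈? S
    ... | yes pv∈S = pv∈S
    ... | no pv∉S = contradiction (subst (_∈ S) (sym (injective ∈⊤ ∈⊤ (partner-∉ pv∉S))) v∈S) pv∉S

  update-injective : ∀ {f : Config q n → Config q n} σ → Injective _≡_ _≡_ (applySchedule f σ) →
                     ∀ i → Injective _≡_ _≡_ (update f (List.lookup σ i))
  update-injective (S ∷ σ) f^σ-injective zero eq = f^σ-injective (cong (applySchedule _ σ) eq)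
  update-injective {f = f} (S ∷ σ) f^σ-injective (suc i) = update-injective σ rest-injective i
    where
    -- the first block is injective, hence onto, so the rest of the schedule is injective
    first-injective : Injective _≡_ _≡_ (update f S)
    first-injective eq = f^σ-injective (cong (applySchedule f σ) eq)
    rest-injective : Injective _≡_ _≡_ (applySchedule f σ)
    rest-injective {a} {b} eq with Config-injective⇒strictlySurjective first-injective a
                                | Config-injective⇒strictlySurjective first-injective b
    ... | x , refl | y , refl = cong (update f S) (f^σ-injective eq)

  BlockSequential⇒ArcPermutation : ∀ {D : Digraph n} {f : Config q n → Config q n} {σ} → 2 ≤ q → HasIG f D →
    BlockSequential σ → Injective _≡_ _≡_ (applySchedule f σ) → ArcPermutation (transpose D)
  BlockSequential⇒ArcPermutation {n} {D = D} {f} {σ} 1<q IG[f]=D (covered , disjoint) f^σ-injective =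
    p , p-injective , p-arc
    where
    block : Fin n → Fin (length σ)
    block v = proj₁ (covered v)

    matching : ∀ i → Matching (blockGraph D (List.lookup σ i)) ⊤
    matching i = injective⇒Matching 1<q (IG-update {f = f} IG[f]=D (List.lookup σ i))
                                          (update-injective σ f^σ-injective i)

    partner : Fin (length σ) → Fin n → Fin n
    partner i = Matching.partner (matching i)

    p : Fin n → Fin n
    p v = partner (block v) v

    p-arc : ∀ v → Arc D (p v) v
    p-arc v = BlockMatching.partner-arc (matching (block v)) (proj₂ (covered v))

    injective-across : ∀ i j {x y} → x ∈ List.lookup σ i → y ∈ List.lookup σ j → partner i x ≡ partner j y → x ≡ y
    injective-across i j x∈ y∈ eq with i ≟ j
    ... | yes refl = Matching.injective (matching i) ∈⊤ ∈⊤ eq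
    ... | no i≢j = contradiction (subst (_∈ List.lookup σ j) (sym eq) (BlockMatching.partner-∈ (matching j) y∈))
                     (disjoint i j i≢j _ (BlockMatching.partner-∈ (matching i) x∈))

    p-injective : Injective _≡_ _≡_ p
    p-injective = injective-across _ _ (proj₂ (covered _)) (proj₂ (covered _))

  update-⊤ : ∀ (f : Config q n → Config q n) x → update f ⊤ x ≡ f x
  update-⊤ f x = lookup-extensionality λ v →
    trans (lookup-update f ⊤ x v) (cong (λ b → if b then lookup (f x) v else lookup x v) (lookup-replicate v true))

  parallel : Schedule n
  parallel = ⊤ ∷ []

  BlockSequential-parallel : BlockSequential {n} parallel
  BlockSequential-parallel = (λ _ → zero , ∈⊤) , λ { zero zero 0≢0 → contradiction refl 0≢0 }

  IsPermutation-parallel : ∀ {f : Config q n → Config q n} → IsPermutation f →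
                           IsPermutation (applySchedule f parallel)
  IsPermutation-parallel {f = f} (f-injective , f-surjective) =
    (λ {x} {y} eq → f-injective (trans (sym (update-⊤ f x)) (trans eq (update-⊤ f y)))) ,
    λ y → proj₁ (f-surjective y) , λ { refl → trans (update-⊤ f _) (proj₂ (f-surjective y) refl) }

open Hall
open CycleCovers
open Configurations
open BijectiveNetworks
open Schedules

corollary5 : ∀ (n q : ℕ) (D : Digraph n) → 3 ≤ q →
    ((Σ (Config q n → Config q n) λ f → InF D q f × IsPermutation f)
      ⇔ CycleCover D)
    × ((Σ (Config q n → Config q n) λ f → Σ (Schedule n) λ σ →
          InF D q f × BlockSequential σ × IsPermutation (applySchedule f σ))
      ⇔ CycleCover D)
corollary5 n q D 3≤q = mk⇔ network⇒cover cover⇒network , mk⇔ scheduled⇒cover cover⇒scheduled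
  where
  Network : Set
  Network = Σ (Config q n → Config q n) λ f → InF D q f × IsPermutation f
  ScheduledNetwork : Set
  ScheduledNetwork = Σ (Config q n → Config q n) λ f → Σ (Schedule n) λ σ →
                       InF D q f × BlockSequential σ × IsPermutation (applySchedule f σ)

  2≤q : 2 ≤ q
  2≤q = ≤-trans (n≤1+n 2) 3≤q

  toCover : ArcPermutation (transpose D) → CycleCover D
  toCover = ArcPermutation⇒CycleCover ∘ ArcPermutation-transpose {D = transpose D}

  network⇒cover : Network → CycleCover D
  network⇒cover (f , IG[f]=D , f-injective , _) =
    toCover (Matching-⊤⇒ArcPermutation (injective⇒Matching 2≤q (HasIG⇒IG⊆ {g = f} IG[f]=D) f-injective))

  cover⇒network : CycleCover D → Network
  cover⇒network =
    ArcPermutation⇒bijectiveNetwork 3≤q ∘ ArcPermutation-transpose {D = D} ∘ CycleCover⇒ArcPermutation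

  scheduled⇒cover : ScheduledNetwork → CycleCover D
  scheduled⇒cover (f , σ , IG[f]=D , σ-blockSequential , f^σ-injective , _) =
    toCover (BlockSequential⇒ArcPermutation {f = f} {σ} 2≤q IG[f]=D σ-blockSequential f^σ-injective)

  cover⇒scheduled : CycleCover D → ScheduledNetwork
  cover⇒scheduled cover with cover⇒network cover
  ... | f , IG[f]=D , f-bijective =
    f , parallel , IG[f]=D , BlockSequential-parallel , IsPermutation-parallel f-bijective
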